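{- Let $G$ be a graph with a distance-$d_G$ fall coloring $f_G$ using $k_G$ colors, and let $H$ be a graph with a distance-$d_H$ fall coloring $f_H$ using $k_H$ colors. Then the coloring of the cartesian product $G\Box H$ defined by $(g,h)\mapsto (f_G(g),f_H(h))$ is a distance-$(d_G+d_H)$ fall coloring of $G\Box H$ with $k_Gk_H$ colors.
   Context: All graphs are finite and simple. A proper coloring assigns colors to vertices so that adjacent vertices receive different colors. A proper coloring with a given set of $k$ colors is called distance-$d$ fall if every vertex is within (shortest-path) distance $d$ of at least one vertex of every one of the $k$ colors. The cartesian product $G\Box H$ has vertex set $V(G)\times V(H)$, with $(g,h)$ adjacent to $(g',h')$ iff either $g=g'$ and $hh'\in E(H)$, or $h=h'$ and $gg'\in E(G)$. -}

module Defs where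

open import Data.Nat using (ℕ; zero; suc; _≤_; _*_)
open import Data.Fin using (Fin; combine; remQuot)
open import Data.Product using (Σ; _×_; _,_)
open import Data.Sum using (_⊎_)
open import Relation.Binary.PropositionalEquality using (_≡_)
open import Relation.Nullary using (¬_)

record Graph : Set₁ where
  field
    n      : ℕ
    Adj    : Fin n → Fin n → Set
    sym    : ∀ {u v} → Adj u v → Adj v u
    irrefl : ∀ {u} → ¬ Adj u u
open Graph public

data Walk (G : Graph) : Fin (n G) → Fin (n G) → ℕ → Set where
  nil  : ∀ {u} → Walk G u u 0
  cons : ∀ {u v w l} → Adj G u v → Walk G v w l → Walk G u w (suc l)

-- Shortest-path distance between u and v is at most d
-- (the distance is the minimum walk length, so this holds iff a walk of length ≤ d exists).
DistLe : (G : Graph) → Fin (n G) → Fin (n G) → ℕ → Set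
DistLe G u v d = Σ ℕ λ l → l ≤ d × Walk G u v l

Proper : (G : Graph) (k : ℕ) → (Fin (n G) → Fin k) → Set
Proper G k f = ∀ u v → Adj G u v → ¬ (f u ≡ f v)

IsDistFall : (G : Graph) (d k : ℕ) → (Fin (n G) → Fin k) → Set
IsDistFall G d k f =
  Proper G k f × (∀ v (c : Fin k) → Σ (Fin (n G)) λ u → f u ≡ c × DistLe G v u d)

-- Cartesian product G □ H; the vertex (g , h) is encoded as combine g h : Fin (nG * nH).
ProdAdjPair : (G H : Graph) → (Fin (n G) × Fin (n H)) → (Fin (n G) × Fin (n H)) → Set
ProdAdjPair G H (g , h) (g' , h') = (g ≡ g' × Adj H h h') ⊎ (h ≡ h' × Adj G g g')

open import Data.Sum using (inj₁; inj₂)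
open import Relation.Binary.PropositionalEquality using (refl)

private
  pairSym : (G H : Graph) → ∀ {x y} → ProdAdjPair G H x y → ProdAdjPair G H y x
  pairSym G H {g , h} {g' , h'} (inj₁ (refl , a)) = inj₁ (refl , Graph.sym H a)
  pairSym G H {g , h} {g' , h'} (inj₂ (refl , a)) = inj₂ (refl , Graph.sym G a)

  pairIrr : (G H : Graph) → ∀ {x} → ¬ ProdAdjPair G H x x
  pairIrr G H {g , h} (inj₁ (_ , a)) = irrefl H a
  pairIrr G H {g , h} (inj₂ (_ , a)) = irrefl G a

_□_ : Graph → Graph → Graph
G □ H = record
  { n      = n G * n H
  ; Adj    = λ x y → ProdAdjPair G H (remQuot (n H) x) (remQuot (n H) y)
  ; sym    = pairSym G H
  ; irrefl = pairIrr G H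
  }

prodColoring : (G H : Graph) {kG kH : ℕ} → (Fin (n G) → Fin kG) → (Fin (n H) → Fin kH)
             → Fin (n (G □ H)) → Fin (kG * kH)
prodColoring G H fG fH x with remQuot (n H) x
... | (g , h) = combine (fG g) (fH h)

-- A walk in one factor lifts to G □ H with the other coordinate fixed, so the distance from
-- (g , h) to (u , u') is at most d(g , u) + d(h , u'). Taking u within dG of g of colour c and
-- u' within dH of h of colour c' gives a vertex of colour (c , c') within dG + dH of (g , h).
-- An edge of G □ H moves one coordinate along an edge of its factor, so the colouring is proper.
module Submission where

open import Defs hiding (sym)
open import Data.Nat using (ℕ; _+_; _*_)
open import Data.Nat.Properties using (+-mono-≤)
open import Data.Fin using (Fin; combine)
open import Data.Fin.Properties using (remQuot-combine; combine-surjective; combine-injectiveˡ; combine-injectiveʳ)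
open import Data.Product using (Σ; _×_; _,_)
open import Data.Sum using (inj₁; inj₂)
open import Relation.Binary.PropositionalEquality using (_≡_; _≢_; refl; sym; trans; cong; subst₂)

combine-elim : ∀ {ℓ m k} (P : Fin (m * k) → Set ℓ) → (∀ i j → P (combine i j)) → ∀ x → P x
combine-elim {m = m} {k} P p x with combine-surjective {m} {k} x
... | i , j , refl = p i j

module _ {G : Graph} where

  _++ʷ_ : ∀ {u v w l m} → Walk G u v l → Walk G v w m → Walk G u w (l + m)
  nil      ++ʷ q = q
  cons a p ++ʷ q = cons a (p ++ʷ q)

  DistLe-trans : ∀ {u v w d e} → DistLe G u v d → DistLe G v w e → DistLe G u w (d + e)
  DistLe-trans (l , l≤d , p) (m , m≤e , q) = l + m , +-mono-≤ l≤d m≤e , p ++ʷ q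

AllColoursWithin : (G : Graph) (d k : ℕ) → (Fin (n G) → Fin k) → Set
AllColoursWithin G d k f = ∀ v (c : Fin k) → Σ (Fin (n G)) λ u → f u ≡ c × DistLe G v u d

module _ {G H : Graph} where

  private
    variable
      g g' : Fin (n G)
      h h' : Fin (n H)

  pair⇒□-adj : ProdAdjPair G H (g , h) (g' , h')
             → Adj (G □ H) (combine g h) (combine g' h')
  pair⇒□-adj {g = g} {h = h} {g' = g'} {h' = h'} =
    subst₂ (ProdAdjPair G H) (sym (remQuot-combine g h)) (sym (remQuot-combine g' h'))

  □-adj⇒pair : Adj (G □ H) (combine g h) (combine g' h')
             → ProdAdjPair G H (g , h) (g' , h')
  □-adj⇒pair {g = g} {h = h} {g' = g'} {h' = h'} =
    subst₂ (ProdAdjPair G H) (remQuot-combine g h) (remQuot-combine g' h')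

  walk-□ˡ : ∀ {l} (h : Fin (n H)) → Walk G g g' l → Walk (G □ H) (combine g h) (combine g' h) l
  walk-□ˡ h nil        = nil
  walk-□ˡ h (cons a p) = cons (pair⇒□-adj (inj₂ (refl , a))) (walk-□ˡ h p)

  walk-□ʳ : ∀ {l} (g : Fin (n G)) → Walk H h h' l → Walk (G □ H) (combine g h) (combine g h') l
  walk-□ʳ g nil        = nil
  walk-□ʳ g (cons a p) = cons (pair⇒□-adj (inj₁ (refl , a))) (walk-□ʳ g p)

  DistLe-□ : ∀ {dG dH} → DistLe G g g' dG → DistLe H h h' dH
           → DistLe (G □ H) (combine g h) (combine g' h') (dG + dH)
  DistLe-□ {g' = g'} {h = h} (l , l≤ , p) (m , m≤ , q) =
    DistLe-trans (l , l≤ , walk-□ˡ h p) (m , m≤ , walk-□ʳ g' q)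

module _ (G H : Graph) {kG kH : ℕ} (fG : Fin (n G) → Fin kG) (fH : Fin (n H) → Fin kH) where

  prodColoring-combine : ∀ g h → prodColoring G H fG fH (combine g h) ≡ combine (fG g) (fH h)
  prodColoring-combine g h =
    cong (λ (i , j) → combine (fG i) (fH j)) (remQuot-combine g h)

  prodColoring-proper : Proper G kG fG → Proper H kH fH
                      → Proper (G □ H) (kG * kH) (prodColoring G H fG fH)
  prodColoring-proper properG properH =
    combine-elim _ λ g h → combine-elim _ λ g' h' adj same →
      separate (□-adj⇒pair {G = G} {H} adj)
        (trans (sym (prodColoring-combine g h)) (trans same (prodColoring-combine g' h')))
    where
    separate : ∀ {g g' h h'} → ProdAdjPair G H (g , h) (g' , h')
             → combine (fG g) (fH h) ≢ combine (fG g') (fH h')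
    separate {g} {_} {h} {h'} (inj₁ (refl , a)) e =
      properH h h' a (combine-injectiveʳ (fG g) (fH h) (fG g) (fH h') e)
    separate {g} {g'} {h} (inj₂ (refl , a)) e =
      properG g g' a (combine-injectiveˡ (fG g) (fH h) (fG g') (fH h) e)

  prodColoring-allColoursWithin : ∀ {dG dH}
    → AllColoursWithin G dG kG fG → AllColoursWithin H dH kH fH
    → AllColoursWithin (G □ H) (dG + dH) (kG * kH) (prodColoring G H fG fH)
  prodColoring-allColoursWithin {dG} {dH} nearG nearH =
    combine-elim _ λ g h → combine-elim _ λ c c' → pick (nearG g c) (nearH h c')
    where
    pick : ∀ {g h c c'}
         → Σ (Fin (n G)) (λ u → fG u ≡ c × DistLe G g u dG)
         → Σ (Fin (n H)) (λ u' → fH u' ≡ c' × DistLe H h u' dH)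
         → Σ (Fin (n (G □ H))) λ v → prodColoring G H fG fH v ≡ combine c c'
                                   × DistLe (G □ H) (combine g h) v (dG + dH)
    pick (u , refl , g~u) (u' , refl , h~u') =
      combine u u' , prodColoring-combine u u' , DistLe-□ g~u h~u'

mainTheorem7 : (G H : Graph) (dG dH kG kH : ℕ)
    (fG : Fin (n G) → Fin kG) (fH : Fin (n H) → Fin kH)
    → IsDistFall G dG kG fG → IsDistFall H dH kH fH
    → IsDistFall (G □ H) (dG + dH) (kG * kH) (prodColoring G H fG fH)
mainTheorem7 G H dG dH kG kH fG fH (properG , nearG) (properH , nearH) =
  prodColoring-proper G H fG fH properG properH ,
  prodColoring-allColoursWithin G H fG fH nearG nearH
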